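{- Let $m\ge2$ and $n_1>\cdots>n_m>0$ be integers, and let $(n_1(p),\dots,n_m(p))\times[k_1(p),\dots,k_m(p)]=\tilde T^p((n_1,\dots,n_m)\times[1,0,\dots,0])$ for every $p\ge0$ for which this iterate is defined. If $\tilde T^{p+1}$ is defined and $k_1(p)<k_1(p+1)$, then $k_2(p)>0$.
   Context: $(n_1,\dots,n_m)\times[k_1,\dots,k_m]$ denotes the partition with $k_i$ parts $n_i$ ($k_i\ge0$). The extended slow-Triangle map is $\tilde T=\tilde T_0$ if $n_2+n_m>n_1$ and $\tilde T=\tilde T_1$ if $n_2+n_m<n_1$ (undefined if equal), with $\tilde T_0((n_1,\dots,n_m)\times[k_1,\dots,k_m])=(n_2,\dots,n_m,n_1-n_2)\times[k_1+k_2,k_3,\dots,k_m,k_1]$ and $\tilde T_1((n_1,\dots,n_m)\times[k_1,\dots,k_m])=(n_1-n_m,n_2,\dots,n_m)\times[k_1,\dots,k_{m-1},k_1+k_m]$. -}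

module Defs where

open import Data.Nat using (ℕ; zero; suc; _+_; _∸_; _<_)
open import Data.Nat.Properties using (<-cmp)
open import Data.Vec using (Vec; []; _∷_; _∷ʳ_; last; init; replicate; head)
open import Data.Maybe using (Maybe; just; nothing; _>>=_)
open import Data.Product using (_×_; _,_; proj₁; proj₂)
open import Relation.Binary.Definitions using (tri<; tri≈; tri>)

-- A partition (n_1,...,n_m) × [k_1,...,k_m] with m = 2 + r parts-sizes:
-- the pair (vector of n_i, vector of multiplicities k_i).
Part : ℕ → Set
Part r = Vec ℕ (suc (suc r)) × Vec ℕ (suc (suc r))

T₀ : ∀ {r} → Part r → Part r
T₀ (n₁ ∷ n₂ ∷ ns , k₁ ∷ k₂ ∷ ks) = (n₂ ∷ (ns ∷ʳ (n₁ ∸ n₂))) , ((k₁ + k₂) ∷ (ks ∷ʳ k₁))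

T₁ : ∀ {r} → Part r → Part r
T₁ (n₁ ∷ n₂ ∷ ns , k₁ ∷ k₂ ∷ ks) =
  ((n₁ ∸ last (n₂ ∷ ns)) ∷ n₂ ∷ ns) ,
  (k₁ ∷ (init (k₂ ∷ ks) ∷ʳ (k₁ + last (k₂ ∷ ks))))

T̃ : ∀ {r} → Part r → Maybe (Part r)
T̃ {r} (n₁ ∷ n₂ ∷ ns , ks) with <-cmp n₁ (n₂ + last (n₂ ∷ ns))
... | tri< _ _ _ = just (T₀ (n₁ ∷ n₂ ∷ ns , ks))
... | tri≈ _ _ _ = nothing
... | tri> _ _ _ = just (T₁ (n₁ ∷ n₂ ∷ ns , ks))

T̃^ : ∀ {r} → ℕ → Part r → Maybe (Part r)
T̃^ zero x = just x
T̃^ (suc p) x = T̃^ p x >>= T̃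

start : ∀ {r} → Vec ℕ (suc (suc r)) → Part r
start {r} ns = ns , (1 ∷ replicate (suc r) 0)

k₁ : ∀ {r} → Part r → ℕ
k₁ (_ , k ∷ _) = k

k₂ : ∀ {r} → Part r → ℕ
k₂ (_ , _ ∷ k ∷ _) = k

-- Only T̃₀ changes the first multiplicity, and it adds k₂ to it; so if k₁ grows
-- in one step, that step was T̃₀ and k₂ was positive. Nothing about the starting
-- partition is used: the claim holds for every defined step of T̃.
module Submission where

open import Defs
open import Data.Nat using (ℕ; suc; zero; _<_; _>_; _+_; s≤s; z≤n)
open import Data.Nat.Properties using (<-cmp; <-irrefl; +-identityʳ)
open import Data.Vec using (Vec; last; _∷_)
open import Data.Vec.Relation.Unary.Linked using (Linked)
open import Data.Maybe using (just)
open import Data.Product using (_,_)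
open import Data.Empty using (⊥-elim)
open import Relation.Binary.PropositionalEquality using (_≡_; refl; sym; trans; subst)
open import Relation.Binary.Definitions using (tri<; tri≈; tri>)

k₁-T₀ : ∀ {r} (x : Part r) → k₁ (T₀ x) ≡ k₁ x + k₂ x
k₁-T₀ (_ ∷ _ ∷ _ , _ ∷ _ ∷ _) = refl

k₁-T₁ : ∀ {r} (x : Part r) → k₁ (T₁ x) ≡ k₁ x
k₁-T₁ (_ ∷ _ ∷ _ , _ ∷ _ ∷ _) = refl

k₂>0-if-k₁-grows-under-T₀ : ∀ {r} (x : Part r) → k₁ x < k₁ (T₀ x) → k₂ x > 0
k₂>0-if-k₁-grows-under-T₀ x lt with k₂ x | k₁-T₀ x
... | zero  | eq = ⊥-elim (<-irrefl refl (subst (k₁ x <_) (trans eq (+-identityʳ (k₁ x))) lt))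
... | suc _ | _  = s≤s z≤n

k₂>0-if-k₁-grows-under-T̃ : ∀ {r} (x y : Part r) → T̃ x ≡ just y → k₁ x < k₁ y → k₂ x > 0
k₂>0-if-k₁-grows-under-T̃ x@(n₁ ∷ n₂ ∷ ns , _) y eq lt with <-cmp n₁ (n₂ + last (n₂ ∷ ns)) | eq
... | tri< _ _ _ | refl = k₂>0-if-k₁-grows-under-T₀ x lt
... | tri≈ _ _ _ | ()
... | tri> _ _ _ | refl = ⊥-elim (<-irrefl (sym (k₁-T₁ x)) lt)

T̃^-suc-step : ∀ {r} (p : ℕ) (s x y : Part r) →
  T̃^ p s ≡ just x → T̃^ (suc p) s ≡ just y → T̃ x ≡ just y
T̃^-suc-step p s x y ex ey rewrite ex = ey

lemma5p9 : (r : ℕ) (ns : Vec ℕ (suc (suc r))) →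
    Linked _>_ ns → 0 < last ns →
    (p : ℕ) (x y : Part r) →
    T̃^ p (start ns) ≡ just x → T̃^ (suc p) (start ns) ≡ just y →
    k₁ x < k₁ y → k₂ x > 0
lemma5p9 r ns _ _ p x y ex ey =
  k₂>0-if-k₁-grows-under-T̃ x y (T̃^-suc-step p (start ns) x y ex ey)
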